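{- Let $G$ be a connected graph which has a connected spanning subgraph $G'$ such that (a) $G'$ contains all the triangles of $G$, and (b) $k(G')=1$. Then $k(G)\le\dim\mathcal{H}(G)+1$.
   Context: All graphs are finite, simple and undirected. A triangle is a cycle of length $3$. The competition graph $C(D)$ of an acyclic digraph $D$ is the graph with vertex set $V(D)$ having an edge between distinct $x,y$ iff there is a vertex $v$ with $(x,v),(y,v)\in A(D)$. The competition number $k(G)$ is the smallest $k\ge0$ such that $G$ together with $k$ new isolated vertices is the competition graph of some acyclic digraph. A hole of $G$ is an induced subgraph of $G$ which is a cycle of length at least $4$. For a cycle $C$ of $G$, $\chi_C:E(G)\to\mathbb{F}_2$ is the indicator map of $E(C)$. The hole space $\mathcal{H}(G)$ is the $\mathbb{F}_2$-span of $\{\chi_C: C\text{ a hole of }G\}$ in $\mathbb{F}_2^{E(G)}$. -}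

module Defs where

open import Data.Nat using (ℕ; zero; suc; _+_; _≤_; _<_; _≡ᵇ_)
open import Data.Fin using (Fin; toℕ; splitAt)
open import Data.Bool using (Bool; true; false; _∧_; _∨_; _xor_)
open import Data.List using (List; foldr)
open import Data.Product using (Σ; ∃; _×_; _,_)
open import Data.Sum using (_⊎_; inj₁; inj₂)
open import Relation.Binary.PropositionalEquality using (_≡_; _≢_)
open import Relation.Nullary using (¬_)
open import Function.Bundles using (_⇔_)
open import Function.Definitions using (Injective)
open import Relation.Binary.Construct.Closure.ReflexiveTransitive using (Star)
open import Relation.Binary.Construct.Closure.Transitive using (TransClosure)

record Graph (n : ℕ) : Set where
  field
    adj    : Fin n → Fin n → Bool
    sym    : ∀ x y → adj x y ≡ adj y x
    irrefl : ∀ x → adj x x ≡ false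
open Graph public

Adj : ∀ {n} → Graph n → Fin n → Fin n → Set
Adj G x y = adj G x y ≡ true

Connected : ∀ {n} → Graph n → Set
Connected G = ∀ x y → Star (Adj G) x y

SpanningSubgraph : ∀ {n} → Graph n → Graph n → Set
SpanningSubgraph H G = ∀ x y → Adj H x y → Adj G x y

ContainsAllTriangles : ∀ {n} → Graph n → Graph n → Set
ContainsAllTriangles H G =
  ∀ x y z → Adj G x y → Adj G y z → Adj G x z →
  Adj H x y × Adj H y z × Adj H x z

Digraph : ℕ → Set
Digraph m = Fin m → Fin m → Bool

Arc : ∀ {m} → Digraph m → Fin m → Fin m → Set
Arc D x y = D x y ≡ true

Acyclic : ∀ {m} → Digraph m → Set
Acyclic D = ∀ v → ¬ TransClosure (Arc D) v v

-- adjacency of G ∪ I_k (G together with k new isolated vertices),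
-- on vertex set Fin (n + k); the first n vertices are those of G
adjIso : ∀ {n} (k : ℕ) → Graph n → Fin (n + k) → Fin (n + k) → Bool
adjIso {n} k G x y with splitAt n x | splitAt n y
... | inj₁ a | inj₁ b = adj G a b
... | _      | _      = false

IsCompetitionGraphOf : ∀ {n} (k : ℕ) → Graph n → Digraph (n + k) → Set
IsCompetitionGraphOf k G D =
  ∀ x y → x ≢ y → (adjIso k G x y ≡ true ⇔ (∃ λ v → Arc D x v × Arc D y v))

Realizable : ∀ {n} → Graph n → ℕ → Set
Realizable {n} G k = Σ (Digraph (n + k)) λ D → Acyclic D × IsCompetitionGraphOf k G D

IsCompetitionNumber : ∀ {n} → Graph n → ℕ → Set
IsCompetitionNumber G k = Realizable G k × (∀ j → j < k → ¬ Realizable G j)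

eqF : ∀ {n} → Fin n → Fin n → Bool
eqF x y = toℕ x ≡ᵇ toℕ y

consec : (l : ℕ) → Fin l → Fin l → Bool
consec l i j =
  (suc (toℕ i) ≡ᵇ toℕ j) ∨ (suc (toℕ j) ≡ᵇ toℕ i) ∨
  ((toℕ i ≡ᵇ 0) ∧ (suc (toℕ j) ≡ᵇ l)) ∨ ((toℕ j ≡ᵇ 0) ∧ (suc (toℕ i) ≡ᵇ l))

record Hole {n} (G : Graph n) : Set where
  field
    len     : ℕ
    len≥4   : 4 ≤ len
    vert    : Fin len → Fin n
    inj     : Injective _≡_ _≡_ vert
    induced : ∀ i j → adj G (vert i) (vert j) ≡ consec len i j
open Hole public

anyFin : (m : ℕ) → (Fin m → Bool) → Bool
anyFin zero    f = false
anyFin (suc m) f = f Fin.zero ∨ anyFin m (λ i → f (Fin.suc i))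

xorFin : (m : ℕ) → (Fin m → Bool) → Bool
xorFin zero    f = false
xorFin (suc m) f = f Fin.zero xor xorFin m (λ i → f (Fin.suc i))

-- vectors of F₂^{E(G)}; a vector is a function on pairs of vertices,
-- only its values on edges {x,y} with x < y matter (see _≈E_)
EdgeVec : ℕ → Set
EdgeVec n = Fin n → Fin n → Bool

_≈E_ : ∀ {n} {G : Graph n} → EdgeVec n → EdgeVec n → Set
_≈E_ {G = G} v w = ∀ x y → toℕ x < toℕ y → Adj G x y → v x y ≡ w x y

zeroV : ∀ {n} → EdgeVec n
zeroV x y = false

_⊕_ : ∀ {n} → EdgeVec n → EdgeVec n → EdgeVec n
(v ⊕ w) x y = v x y xor w x y

χ : ∀ {n} {G : Graph n} → Hole G → EdgeVec n
χ C x y = anyFin (len C) λ i → anyFin (len C) λ j →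
  consec (len C) i j ∧ eqF (vert C i) x ∧ eqF (vert C j) y

-- v ∈ 𝓗(G): v is an F₂-linear combination (= sum of a finite list) of χ_C's
InHoleSpace : ∀ {n} (G : Graph n) → EdgeVec n → Set
InHoleSpace G v = Σ (List (Hole G)) λ Cs → _≈E_ {G = G} v (foldr (λ C w → χ C ⊕ w) zeroV Cs)

linComb : ∀ {n} {d : ℕ} → (Fin d → Bool) → (Fin d → EdgeVec n) → EdgeVec n
linComb {d = d} a b x y = xorFin d λ i → a i ∧ b i x y

HoleSpaceDim : ∀ {n} (G : Graph n) → ℕ → Set
HoleSpaceDim {n} G d = Σ (Fin d → EdgeVec n) λ b →
  (∀ i → InHoleSpace G (b i)) ×
  (∀ (a : Fin d → Bool) → _≈E_ {G = G} (linComb a b) zeroV → ∀ i → a i ≡ false) ×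
  (∀ v → InHoleSpace G v → Σ (Fin d → Bool) λ a → _≈E_ {G = G} v (linComb a b))

module Submission where

-- Let F be the set of edges of G that are not edges of G′, and m = |F|.
-- (1) m ≤ dim 𝓗(G).  An edge uv ∈ F closes a G′-path from v to u into a
--     closed walk of G whose only F-edge is uv.  Edges of F lie in no
--     triangle of G (all triangles are in G′), and on such edges the edge
--     parity of any closed walk equals a sum of hole indicators: split the
--     walk at a repeated vertex or at a chord until only holes and
--     triangles remain.  So for every e ∈ F some h_e ∈ 𝓗(G) restricts to
--     the indicator of e on F; expanding the h_e in a basis of size d gives
--     vectors a_e, c_f ∈ F₂^d with a_e · c_f = [e = f], whence m ≤ d.
-- (2) k(G) ≤ m + 1.  An acyclic digraph whose competition graph is G′ ∪ I₁
--     is extended by one new sink per edge uv ∈ F, with arcs u → sink and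
--     v → sink; its competition graph is G ∪ I_{1+m}, padded to I_{1+d}.

open import Defs hiding (sym)
open import Data.Nat using (ℕ; zero; suc; _+_; _≤_; _<_; z≤n; s≤s; _≡ᵇ_)
open import Data.Nat.Properties
  using (≡ᵇ⇒≡; ≡⇒≡ᵇ; m≤n⇒m≤1+n; <-cmp; <-irrefl; <-asym; ≮⇒≥; suc-injective; +-suc; +-comm;
         +-identityʳ; +-monoʳ-≤; +-mono-≤; m≤m+n; m≤n+m; ≤-trans; ≤-pred; ≤-refl; ≤-reflexive;
         m+1+n≢m; _≤?_; ≰⇒>; _<?_)
open import Data.Nat.Tactic.RingSolver using (solve-∀)
open import Data.Fin using (Fin; zero; suc; toℕ; punchIn; inject≤; splitAt; join; _↑ˡ_; _↑ʳ_; combine; remQuot)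
open import Data.Fin.Properties
  using (_≟_; any?; toℕ-injective; toℕ-inject≤; punchIn-injective; punchInᵢ≢i; splitAt-join;
         join-splitAt; splitAt-↑ˡ; splitAt-↑ʳ; ↑ˡ-injective; remQuot-combine; combine-remQuot)
  renaming (suc-injective to fsuc-injective)
open import Data.Bool using (Bool; true; false; _∧_; _∨_; _xor_)
open import Data.Bool.Properties using (T-≡; xor-comm; xor-assoc; xor-identityʳ; ¬-not)
  renaming (_≟_ to _≟𝔹_)
open import Data.Bool.Solver using (module xor-∧-Solver)
open import Data.List using (List; []; _∷_; _++_; _∷ʳ_; length; foldr; lookup)
open import Data.List.Properties using (++-assoc; ++-identityʳ; length-++)
open import Data.List.Membership.Propositional using (_∈_; _∉_)
open import Data.List.Membership.Propositional.Properties using (∈-lookup; ∈-∃++; ∈-++⁻; ∈-++⁺ˡ)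
open import Data.List.Relation.Unary.Any using (here; there; index)
open import Data.List.Relation.Unary.Any.Properties using (lookup-index)
open import Data.Product using (Σ; ∃; _,_; _×_; proj₁; proj₂; uncurry)
open import Data.Sum using (_⊎_; inj₁; inj₂)
open import Data.Unit using (⊤; tt)
open import Data.Empty using (⊥; ⊥-elim)
open import Function using (_∘_)
open import Function.Bundles using (Equivalence; mk⇔)
open import Relation.Binary.PropositionalEquality
open import Relation.Binary.Definitions using (tri<; tri≈; tri>)
open import Relation.Binary.Construct.Closure.ReflexiveTransitive using (Star; ε; _◅_)
open import Relation.Binary.Construct.Closure.Transitive using (TransClosure; [_]; _∷_)
open import Relation.Nullary using (¬_; Dec; yes; no; does; contradiction)
open import Relation.Nullary.Decidable using (_×-dec_; _⊎-dec_; ¬?; dec-true; dec-false)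

∨-inˡ : ∀ {a} b → a ≡ true → a ∨ b ≡ true
∨-inˡ b refl = refl

∨-inʳ : ∀ a {b} → b ≡ true → a ∨ b ≡ true
∨-inʳ false p = p
∨-inʳ true  p = refl

∧-in : ∀ {a b} → a ≡ true → b ≡ true → a ∧ b ≡ true
∧-in refl p = p

∨-out : ∀ a {b} → a ∨ b ≡ true → (a ≡ true) ⊎ (b ≡ true)
∨-out true  _ = inj₁ refl
∨-out false p = inj₂ p

∧-out : ∀ a {b} → a ∧ b ≡ true → (a ≡ true) × (b ≡ true)
∧-out true  p = refl , p
∧-out false ()

≡-by-truth : ∀ {a b} → (a ≡ true → b ≡ true) → (b ≡ true → a ≡ true) → a ≡ b
≡-by-truth {false} {false} _ _ = refl
≡-by-truth {false} {true}  _ g = g refl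
≡-by-truth {true}  {false} f _ = sym (f refl)
≡-by-truth {true}  {true}  _ _ = refl

xor≡false⇒≡ : ∀ x y → x xor y ≡ false → y ≡ x
xor≡false⇒≡ false false _ = refl
xor≡false⇒≡ true  true  _ = refl

does-sound : ∀ {P : Set} (P? : Dec P) → does P? ≡ true → P
does-sound (yes p) _ = p
does-sound (no _) ()

≡ᵇ-sound : ∀ m k → (m ≡ᵇ k) ≡ true → m ≡ k
≡ᵇ-sound m k p = ≡ᵇ⇒≡ m k (Equivalence.from T-≡ p)

≡ᵇ-complete : ∀ {m k} → m ≡ k → (m ≡ᵇ k) ≡ true
≡ᵇ-complete {m} {k} e = Equivalence.to T-≡ (≡⇒≡ᵇ m k e)

eqF-sound : ∀ {m} (a b : Fin m) → eqF a b ≡ true → a ≡ b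
eqF-sound a b p = toℕ-injective (≡ᵇ-sound _ _ p)

eqF-refl : ∀ {m} (a : Fin m) → eqF a a ≡ true
eqF-refl a = ≡ᵇ-complete {toℕ a} refl

anyFin-sound : ∀ m (f : Fin m → Bool) → anyFin m f ≡ true → Σ (Fin m) λ i → f i ≡ true
anyFin-sound (suc m) f p with ∨-out (f zero) p
... | inj₁ q = zero , q
... | inj₂ q with anyFin-sound m (f ∘ suc) q
...   | i , r = suc i , r

anyFin-intro : ∀ m (f : Fin m → Bool) i → f i ≡ true → anyFin m f ≡ true
anyFin-intro (suc m) f zero    p = ∨-inˡ _ p
anyFin-intro (suc m) f (suc i) p = ∨-inʳ (f zero) (anyFin-intro m (f ∘ suc) i p)

ConsecP : ℕ → ℕ → ℕ → Set
ConsecP l i j = (suc i ≡ j) ⊎ (suc j ≡ i) ⊎ (i ≡ 0 × suc j ≡ l) ⊎ (j ≡ 0 × suc i ≡ l)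

consec-intro : ∀ l (i j : Fin l) → ConsecP l (toℕ i) (toℕ j) → consec l i j ≡ true
consec-intro l i j c = go c
  where
  b₁ b₂ b₃ b₄ : Bool
  b₁ = suc (toℕ i) ≡ᵇ toℕ j
  b₂ = suc (toℕ j) ≡ᵇ toℕ i
  b₃ = (toℕ i ≡ᵇ 0) ∧ (suc (toℕ j) ≡ᵇ l)
  b₄ = (toℕ j ≡ᵇ 0) ∧ (suc (toℕ i) ≡ᵇ l)
  go : ConsecP l (toℕ i) (toℕ j) → b₁ ∨ b₂ ∨ b₃ ∨ b₄ ≡ true
  go (inj₁ e)                   = ∨-inˡ (b₂ ∨ b₃ ∨ b₄) (≡ᵇ-complete e)
  go (inj₂ (inj₁ e))            = ∨-inʳ b₁ (∨-inˡ (b₃ ∨ b₄) (≡ᵇ-complete e))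
  go (inj₂ (inj₂ (inj₁ (e , f)))) = ∨-inʳ b₁ (∨-inʳ b₂ (∨-inˡ b₄ (∧-in (≡ᵇ-complete e) (≡ᵇ-complete f))))
  go (inj₂ (inj₂ (inj₂ (e , f)))) = ∨-inʳ b₁ (∨-inʳ b₂ (∨-inʳ b₃ (∧-in (≡ᵇ-complete e) (≡ᵇ-complete f))))

consec-elim : ∀ l (i j : Fin l) → consec l i j ≡ true → ConsecP l (toℕ i) (toℕ j)
consec-elim l i j p with ∨-out (suc (toℕ i) ≡ᵇ toℕ j) p
... | inj₁ q = inj₁ (≡ᵇ-sound _ _ q)
... | inj₂ p₂ with ∨-out (suc (toℕ j) ≡ᵇ toℕ i) p₂
...   | inj₁ q = inj₂ (inj₁ (≡ᵇ-sound _ _ q))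
...   | inj₂ p₃ with ∨-out ((toℕ i ≡ᵇ 0) ∧ (suc (toℕ j) ≡ᵇ l)) p₃
...     | inj₁ q = let (e , f) = ∧-out (toℕ i ≡ᵇ 0) q in inj₂ (inj₂ (inj₁ (≡ᵇ-sound _ _ e , ≡ᵇ-sound _ _ f)))
...     | inj₂ q = let (e , f) = ∧-out (toℕ j ≡ᵇ 0) q in inj₂ (inj₂ (inj₂ (≡ᵇ-sound _ _ e , ≡ᵇ-sound _ _ f)))

_·_ : ∀ {d} → (Fin d → Bool) → (Fin d → Bool) → Bool
_·_ {d} u w = xorFin d (λ i → u i ∧ w i)

·-linear : ∀ {d} (u w z : Fin d → Bool) l →
           (λ i → u i xor (l ∧ w i)) · z ≡ (u · z) xor (l ∧ (w · z))
·-linear {zero}  u w z false = refl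
·-linear {zero}  u w z true  = refl
·-linear {suc d} u w z l
  rewrite ·-linear (u ∘ suc) (w ∘ suc) (z ∘ suc) l = regroup (u zero) (w zero) (z zero) l _ _
  where
  open xor-∧-Solver
  regroup : ∀ a b c l U W →
            ((a xor (l ∧ b)) ∧ c) xor (U xor (l ∧ W)) ≡ ((a ∧ c) xor U) xor (l ∧ ((b ∧ c) xor W))
  regroup = solve 6 (λ a b c l U W → ((a :+ (l :* b)) :* c) :+ (U :+ (l :* W))
                                   := ((a :* c) :+ U) :+ (l :* ((b :* c) :+ W))) refl

·-drop-zero : ∀ {d} (u w : Fin (suc d) → Bool) → u zero ≡ false → u · w ≡ (u ∘ suc) · (w ∘ suc)
·-drop-zero u w u₀ rewrite u₀ = refl

-- Gaussian elimination step: clearing coordinate 0 of u with a pivot p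
-- (p₀ = 1) preserves the product with every w orthogonal to p.
·-eliminate : ∀ {d} (u p w : Fin (suc d) → Bool) → p zero ≡ true → p · w ≡ false →
              (λ i → u (suc i) xor (u zero ∧ p (suc i))) · (w ∘ suc) ≡ u · w
·-eliminate u p w p₀ p·w = begin
  (λ i → u (suc i) xor (u zero ∧ p (suc i))) · (w ∘ suc)
    ≡⟨ ·-linear (u ∘ suc) (p ∘ suc) (w ∘ suc) (u zero) ⟩
  ((u ∘ suc) · (w ∘ suc)) xor (u zero ∧ ((p ∘ suc) · (w ∘ suc)))
    ≡⟨ cong (λ x → ((u ∘ suc) · (w ∘ suc)) xor (u zero ∧ x)) tail≡w₀ ⟩
  ((u ∘ suc) · (w ∘ suc)) xor (u zero ∧ w zero)
    ≡⟨ xor-comm ((u ∘ suc) · (w ∘ suc)) (u zero ∧ w zero) ⟩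
  u · w ∎
  where
  open ≡-Reasoning
  -- p · w = w₀ + (p∘suc)·(w∘suc) = 0 because p₀ = 1
  tail≡w₀ : (p ∘ suc) · (w ∘ suc) ≡ w zero
  tail≡w₀ = xor≡false⇒≡ (w zero) _ (subst (λ b → (b ∧ w zero) xor ((p ∘ suc) · (w ∘ suc)) ≡ false) p₀ p·w)

-- Induction on d: if no aₜ uses
-- coordinate 0, drop it; otherwise pivot on some a_{t₀} with a_{t₀}(0) = 1,
-- eliminate coordinate 0 from the other rows and discard t₀.
biorthogonal⇒≤ : ∀ d m (a c : Fin m → Fin d → Bool) →
                 (∀ t → a t · c t ≡ true) → (∀ t s → t ≢ s → a t · c s ≡ false) → m ≤ d
biorthogonal⇒≤ zero    zero    a c diag off = z≤n
biorthogonal⇒≤ zero    (suc m) a c diag off with diag zero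
... | ()
biorthogonal⇒≤ (suc d) m a c diag off with any? (λ t → a t zero ≟𝔹 true)
... | no none =
  m≤n⇒m≤1+n (biorthogonal⇒≤ d m (λ t → a t ∘ suc) (λ s → c s ∘ suc)
               (λ t → trans (sym (drop t t)) (diag t))
               (λ t s t≢s → trans (sym (drop t s)) (off t s t≢s)))
  where
  drop : ∀ t s → a t · c s ≡ (a t ∘ suc) · (c s ∘ suc)
  drop t s = ·-drop-zero (a t) (c s) (¬-not (λ e → none (t , e)))
biorthogonal⇒≤ (suc d) (suc m) a c diag off | yes (t₀ , pivot) =
  s≤s (biorthogonal⇒≤ d m a′ c′
         (λ t → trans (reduce t t) (diag (punchIn t₀ t)))
         (λ t s t≢s → trans (reduce t s) (off _ _ (t≢s ∘ punchIn-injective t₀ t s))))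
  where
  a′ : Fin m → Fin d → Bool
  a′ t i = a (punchIn t₀ t) (suc i) xor (a (punchIn t₀ t) zero ∧ a t₀ (suc i))
  c′ : Fin m → Fin d → Bool
  c′ s = c (punchIn t₀ s) ∘ suc
  reduce : ∀ t s → a′ t · c′ s ≡ a (punchIn t₀ t) · c (punchIn t₀ s)
  reduce t s = ·-eliminate (a (punchIn t₀ t)) (a t₀) (c (punchIn t₀ s)) pivot
                 (off t₀ (punchIn t₀ s) (punchInᵢ≢i t₀ s ∘ sym))

record Enumeration {N : ℕ} (P : Fin N → Set) : Set where
  field
    size      : ℕ
    elem      : Fin size → Fin N
    injective : ∀ s t → elem s ≡ elem t → s ≡ t
    sound     : ∀ t → P (elem t)
    complete  : ∀ z → P z → Σ (Fin size) λ t → elem t ≡ z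

enumerate : ∀ {N} (P : Fin N → Set) → (∀ z → Dec (P z)) → Enumeration P
enumerate {zero}  P P? = record { size = 0 ; elem = λ () ; injective = λ () ; sound = λ () ; complete = λ () }
enumerate {suc N} P P? with enumerate (P ∘ suc) (P? ∘ suc) | P? zero
... | E | yes P₀ = record { size = suc size ; elem = elem′ ; injective = injective′
                          ; sound = sound′ ; complete = complete′ }
  where
  open Enumeration E
  elem′ : Fin (suc size) → Fin (suc N)
  elem′ zero    = zero
  elem′ (suc t) = suc (elem t)
  injective′ : ∀ s t → elem′ s ≡ elem′ t → s ≡ t
  injective′ zero    zero    _ = refl
  injective′ (suc s) (suc t) e = cong suc (injective s t (fsuc-injective e))
  sound′ : ∀ t → P (elem′ t)
  sound′ zero    = P₀
  sound′ (suc t) = sound t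
  complete′ : ∀ z → P z → Σ (Fin (suc size)) λ t → elem′ t ≡ z
  complete′ zero    _  = zero , refl
  complete′ (suc z) Pz = let (t , e) = complete z Pz in suc t , cong suc e
... | E | no ¬P₀ = record { size = size ; elem = suc ∘ elem
                          ; injective = λ s t e → injective s t (fsuc-injective e)
                          ; sound = sound ; complete = complete′ }
  where
  open Enumeration E
  complete′ : ∀ z → P z → Σ (Fin size) λ t → suc (elem t) ≡ z
  complete′ zero    P₀ = contradiction P₀ ¬P₀
  complete′ (suc z) Pz = let (t , e) = complete z Pz in t , cong suc e

-- x + s + s + y = x + y in F₂ (s padded with the empty tail false).
xor-cancel-middle : ∀ x s y → (x xor (s xor false)) xor ((s xor false) xor y) ≡ x xor y
xor-cancel-middle false false false = refl
xor-cancel-middle false false true  = refl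
xor-cancel-middle false true  false = refl
xor-cancel-middle false true  true  = refl
xor-cancel-middle true  false false = refl
xor-cancel-middle true  false true  = refl
xor-cancel-middle true  true  false = refl
xor-cancel-middle true  true  true  = refl

-- Cutting a closed walk A ++ p ∷ (M ++ q ∷ B), of length a + (m+1) + (b+1),
-- at a repeated vertex p = q or at a chord pq leaves strictly shorter
-- closed walks (for a chord, both sides of it are nonempty).
repeat-shorter-loop : ∀ a m b → suc (suc m) ≤ a + suc (m + suc b)
repeat-shorter-loop a m b = subst (suc (suc m) ≤_) (sym (regroup a m b)) (m≤m+n _ _)
  where
  regroup : ∀ a m b → a + suc (m + suc b) ≡ suc (suc m) + (a + b)
  regroup = solve-∀

repeat-shorter-rest : ∀ a m b → suc (a + suc b) ≤ a + suc (m + suc b)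
repeat-shorter-rest a m b = subst (suc (a + suc b) ≤_) (sym (regroup a m b)) (m≤m+n _ _)
  where
  regroup : ∀ a m b → a + suc (m + suc b) ≡ suc (a + suc b) + m
  regroup = solve-∀

chord-shorter-loop : ∀ a m b → 1 ≤ a + b → suc (suc (m + 1)) ≤ a + suc (m + suc b)
chord-shorter-loop a m b 1≤a+b = subst₂ _≤_ (sym (regroup₁ m)) (sym (regroup₂ a m b)) (+-monoʳ-≤ (suc (suc m)) 1≤a+b)
  where
  regroup₁ : ∀ m → suc (suc (m + 1)) ≡ suc (suc m) + 1
  regroup₁ = solve-∀
  regroup₂ : ∀ a m b → a + suc (m + suc b) ≡ suc (suc m) + (a + b)
  regroup₂ = solve-∀

chord-shorter-rest : ∀ a m b → 1 ≤ m → suc (a + suc (suc b)) ≤ a + suc (m + suc b)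
chord-shorter-rest a m b 1≤m = subst₂ _≤_ (sym (regroup₁ a b)) (sym (regroup₂ a m b)) (+-monoʳ-≤ (a + suc (suc b)) 1≤m)
  where
  regroup₁ : ∀ a b → suc (a + suc (suc b)) ≡ (a + suc (suc b)) + 1
  regroup₁ = solve-∀
  regroup₂ : ∀ a m b → a + suc (m + suc b) ≡ (a + suc (suc b)) + m
  regroup₂ = solve-∀

-- Walks in G, represented by their vertex sequences, and the edge parity
-- of closed walks (the element of F₂^{E(G)} they determine).
module Walks {n : ℕ} (G : Graph n) where

  V : Set
  V = Fin n

  Crosses : V → V → V → V → Set
  Crosses a b x y = (a ≡ x × b ≡ y) ⊎ (a ≡ y × b ≡ x)

  crosses? : ∀ a b x y → Dec (Crosses a b x y)
  crosses? a b x y = ((a ≟ x) ×-dec (b ≟ y)) ⊎-dec ((a ≟ y) ×-dec (b ≟ x))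

  crosses : V → V → V → V → Bool
  crosses a b x y = does (crosses? a b x y)

  crosses-true : ∀ {a b x y} → Crosses a b x y → crosses a b x y ≡ true
  crosses-true {a} {b} {x} {y} = dec-true (crosses? a b x y)

  crosses-false : ∀ {a b x y} → ¬ Crosses a b x y → crosses a b x y ≡ false
  crosses-false {a} {b} {x} {y} = dec-false (crosses? a b x y)

  crosses-sym : ∀ a b x y → crosses a b x y ≡ crosses b a x y
  crosses-sym a b x y = ≡-by-truth (swap a b) (swap b a)
    where
    swap : ∀ a b → crosses a b x y ≡ true → crosses b a x y ≡ true
    swap a b c with does-sound (crosses? a b x y) c
    ... | inj₁ (p , q) = crosses-true (inj₂ (q , p))
    ... | inj₂ (p , q) = crosses-true (inj₁ (q , p))

  parity : V → V → List V → Bool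
  parity x y []          = false
  parity x y (a ∷ [])    = false
  parity x y (a ∷ b ∷ r) = crosses a b x y xor parity x y (b ∷ r)

  -- The same for the closed walk a ∷ r that returns to a at the end.
  cycParity : V → V → List V → Bool
  cycParity x y []      = false
  cycParity x y (a ∷ r) = parity x y (a ∷ (r ∷ʳ a))

  IsWalk : List V → Set
  IsWalk []          = ⊤
  IsWalk (a ∷ [])    = ⊤
  IsWalk (a ∷ b ∷ r) = Adj G a b × IsWalk (b ∷ r)

  IsClosedWalk : List V → Set
  IsClosedWalk []      = ⊤
  IsClosedWalk (a ∷ r) = IsWalk (a ∷ (r ∷ʳ a))

  parity-++ : ∀ x y xs z ys → parity x y (xs ++ z ∷ ys) ≡ parity x y (xs ∷ʳ z) xor parity x y (z ∷ ys)
  parity-++ x y []            z ys = refl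
  parity-++ x y (a ∷ [])      z ys = cong (_xor parity x y (z ∷ ys)) (sym (xor-identityʳ (crosses a z x y)))
  parity-++ x y (a ∷ b ∷ xs) z ys =
    trans (cong (crosses a b x y xor_) (parity-++ x y (b ∷ xs) z ys))
          (sym (xor-assoc (crosses a b x y) _ _))

  isWalk-++⁻ : ∀ xs z ys → IsWalk (xs ++ z ∷ ys) → IsWalk (xs ∷ʳ z) × IsWalk (z ∷ ys)
  isWalk-++⁻ []            z ys w       = tt , w
  isWalk-++⁻ (a ∷ [])      z ys (e , w) = (e , tt) , w
  isWalk-++⁻ (a ∷ b ∷ xs) z ys (e , w) = let (w₁ , w₂) = isWalk-++⁻ (b ∷ xs) z ys w in (e , w₁) , w₂

  isWalk-++⁺ : ∀ xs z ys → IsWalk (xs ∷ʳ z) → IsWalk (z ∷ ys) → IsWalk (xs ++ z ∷ ys)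
  isWalk-++⁺ []            z ys _        w = w
  isWalk-++⁺ (a ∷ [])      z ys (e , _)  w = e , w
  isWalk-++⁺ (a ∷ b ∷ xs) z ys (e , w₁) w = e , isWalk-++⁺ (b ∷ xs) z ys w₁ w

  closing : ∀ (A : List V) b B a → (A ++ b ∷ B) ∷ʳ a ≡ A ++ b ∷ (B ∷ʳ a)
  closing A b B a = ++-assoc A (b ∷ B) (a ∷ [])

  cycParity-split : ∀ x y a A b B →
    cycParity x y (a ∷ (A ++ b ∷ B)) ≡ parity x y (a ∷ (A ∷ʳ b)) xor parity x y (b ∷ (B ∷ʳ a))
  cycParity-split x y a A b B rewrite closing A b B a = parity-++ x y (a ∷ A) b (B ∷ʳ a)

  isClosedWalk-split⁻ : ∀ a A b B → IsClosedWalk (a ∷ (A ++ b ∷ B)) →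
                        IsWalk (a ∷ (A ∷ʳ b)) × IsWalk (b ∷ (B ∷ʳ a))
  isClosedWalk-split⁻ a A b B w rewrite closing A b B a = isWalk-++⁻ (a ∷ A) b (B ∷ʳ a) w

  isClosedWalk-split⁺ : ∀ a A b B → IsWalk (a ∷ (A ∷ʳ b)) → IsWalk (b ∷ (B ∷ʳ a)) →
                        IsClosedWalk (a ∷ (A ++ b ∷ B))
  isClosedWalk-split⁺ a A b B w₁ w₂ rewrite closing A b B a = isWalk-++⁺ (a ∷ A) b (B ∷ʳ a) w₁ w₂

  cycParity-rotate : ∀ x y A B → cycParity x y (A ++ B) ≡ cycParity x y (B ++ A)
  cycParity-rotate x y []      B       rewrite ++-identityʳ B = refl
  cycParity-rotate x y (a ∷ A) []      rewrite ++-identityʳ A = refl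
  cycParity-rotate x y (a ∷ A) (b ∷ B) =
    trans (cycParity-split x y a A b B)
      (trans (xor-comm (parity x y (a ∷ (A ∷ʳ b))) (parity x y (b ∷ (B ∷ʳ a))))
             (sym (cycParity-split x y b B a A)))

  isClosedWalk-rotate : ∀ A B → IsClosedWalk (A ++ B) → IsClosedWalk (B ++ A)
  isClosedWalk-rotate []      B       w rewrite ++-identityʳ B = w
  isClosedWalk-rotate (a ∷ A) []      w rewrite ++-identityʳ A = w
  isClosedWalk-rotate (a ∷ A) (b ∷ B) w =
    let (w₁ , w₂) = isClosedWalk-split⁻ a A b B w in isClosedWalk-split⁺ b B a A w₂ w₁

  rotate-assoc : ∀ (A : List V) p M q B → (p ∷ (M ++ q ∷ B)) ++ A ≡ p ∷ (M ++ q ∷ (B ++ A))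
  rotate-assoc A p M q B = cong (p ∷_) (++-assoc M (q ∷ B) A)

  cycParity-repeat : ∀ x y A p M B →
    cycParity x y (A ++ p ∷ (M ++ p ∷ B)) ≡ cycParity x y (p ∷ M) xor cycParity x y (A ++ p ∷ B)
  cycParity-repeat x y A p M B = begin
    cycParity x y (A ++ p ∷ (M ++ p ∷ B))      ≡⟨ cycParity-rotate x y A (p ∷ (M ++ p ∷ B)) ⟩
    cycParity x y ((p ∷ (M ++ p ∷ B)) ++ A)    ≡⟨ cong (cycParity x y) (rotate-assoc A p M p B) ⟩
    cycParity x y (p ∷ (M ++ p ∷ (B ++ A)))    ≡⟨ cycParity-split x y p M p (B ++ A) ⟩
    cycParity x y (p ∷ M) xor cycParity x y (p ∷ (B ++ A))
      ≡⟨ cong (cycParity x y (p ∷ M) xor_) (cycParity-rotate x y (p ∷ B) A) ⟩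
    cycParity x y (p ∷ M) xor cycParity x y (A ++ p ∷ B) ∎
    where open ≡-Reasoning

  isClosedWalk-repeat : ∀ A p M B → IsClosedWalk (A ++ p ∷ (M ++ p ∷ B)) →
                        IsClosedWalk (p ∷ M) × IsClosedWalk (A ++ p ∷ B)
  isClosedWalk-repeat A p M B w =
    let (w₁ , w₂) = isClosedWalk-split⁻ p M p (B ++ A)
                      (subst IsClosedWalk (rotate-assoc A p M p B) (isClosedWalk-rotate A (p ∷ (M ++ p ∷ B)) w))
    in w₁ , isClosedWalk-rotate (p ∷ B) A w₂

  cycParity-chord : ∀ x y A p M q B →
    cycParity x y (A ++ p ∷ (M ++ q ∷ B)) ≡
    cycParity x y (p ∷ (M ++ q ∷ [])) xor cycParity x y (A ++ p ∷ q ∷ B)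
  cycParity-chord x y A p M q B = begin
    cycParity x y (A ++ p ∷ (M ++ q ∷ B))
      ≡⟨ cycParity-rotate x y A (p ∷ (M ++ q ∷ B)) ⟩
    cycParity x y ((p ∷ (M ++ q ∷ B)) ++ A)
      ≡⟨ cong (cycParity x y) (rotate-assoc A p M q B) ⟩
    cycParity x y (p ∷ (M ++ q ∷ (B ++ A)))
      ≡⟨ cycParity-split x y p M q (B ++ A) ⟩
    X xor Y
      ≡⟨ sym (xor-cancel-middle X (crosses p q x y) Y) ⟩
    (X xor (crosses p q x y xor false)) xor ((crosses p q x y xor false) xor Y)
      ≡⟨ cong (λ s → (X xor (s xor false)) xor ((crosses p q x y xor false) xor Y)) (crosses-sym p q x y) ⟩
    (X xor (crosses q p x y xor false)) xor ((crosses p q x y xor false) xor Y)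
      ≡⟨ cong₂ _xor_ (sym (cycParity-split x y p M q []))
                     (sym (trans (cycParity-rotate x y A (p ∷ q ∷ B)) (cycParity-split x y p [] q (B ++ A)))) ⟩
    cycParity x y (p ∷ (M ++ q ∷ [])) xor cycParity x y (A ++ p ∷ q ∷ B) ∎
    where
    open ≡-Reasoning
    X Y : Bool
    X = parity x y (p ∷ (M ∷ʳ q))
    Y = parity x y (q ∷ ((B ++ A) ∷ʳ p))

  isClosedWalk-chord : ∀ A p M q B → Adj G p q → IsClosedWalk (A ++ p ∷ (M ++ q ∷ B)) →
                       IsClosedWalk (p ∷ (M ++ q ∷ [])) × IsClosedWalk (A ++ p ∷ q ∷ B)
  isClosedWalk-chord A p M q B pq w =
    let (w₁ , w₂) = isClosedWalk-split⁻ p M q (B ++ A)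
                      (subst IsClosedWalk (rotate-assoc A p M q B) (isClosedWalk-rotate A (p ∷ (M ++ q ∷ B)) w))
    in isClosedWalk-split⁺ p M q [] w₁ (trans (Graph.sym G q p) pq , tt) ,
       isClosedWalk-rotate (p ∷ q ∷ B) A (isClosedWalk-split⁺ p [] q (B ++ A) (pq , tt) w₂)

  -- Write a closed walk as A ++ p ∷ (M ++ q ∷ B).  It has a
  -- shortcut at p, q if p = q (a repeated vertex) or pq is a chord, i.e.
  -- an edge between positions that are not cyclically consecutive.
  NonEmpty : List V → Set
  NonEmpty []      = ⊥
  NonEmpty (_ ∷ _) = ⊤

  nonEmpty? : ∀ xs → Dec (NonEmpty xs)
  nonEmpty? []      = no λ ()
  nonEmpty? (_ ∷ _) = yes tt

  ShortcutAt : List V → V → List V → V → List V → Set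
  ShortcutAt A p M q B = (p ≡ q) ⊎ (Adj G p q × NonEmpty M × NonEmpty (A ++ B))

  shortcutAt? : ∀ A p M q B → Dec (ShortcutAt A p M q B)
  shortcutAt? A p M q B = (p ≟ q) ⊎-dec ((adj G p q ≟𝔹 true) ×-dec (nonEmpty? M ×-dec nonEmpty? (A ++ B)))

  Splits : List V → (List V → V → List V → Set) → Set
  Splits xs P = Σ (List V) λ M → Σ V λ q → Σ (List V) λ B → (xs ≡ M ++ q ∷ B) × P M q B

  splits? : ∀ xs (P : List V → V → List V → Set) → (∀ M q B → Dec (P M q B)) → Dec (Splits xs P)
  splits? []       P P? = no λ { ([] , _ , _ , () , _) ; (_ ∷ _ , _ , _ , () , _) }
  splits? (x ∷ xs) P P? with P? [] x xs
  ... | yes p = yes ([] , x , xs , refl , p)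
  ... | no ¬p with splits? xs (λ M q B → P (x ∷ M) q B) (λ M q B → P? (x ∷ M) q B)
  ...   | yes (M , q , B , e , p) = yes (x ∷ M , q , B , cong (x ∷_) e , p)
  ...   | no ¬ps = no λ { ([] , q , B , refl , p) → ¬p p
                        ; (_ ∷ M , q , B , refl , p) → ¬ps (M , q , B , refl , p) }

  Shortcut : List V → Set
  Shortcut vs = Splits vs (λ A p R → Splits R (λ M q B → ShortcutAt A p M q B))

  shortcut? : ∀ vs → Dec (Shortcut vs)
  shortcut? vs = splits? vs _ (λ A p R → splits? R _ (λ M q B → shortcutAt? A p M q B))

  shortcut-at : ∀ {vs} A p M q B → vs ≡ A ++ p ∷ (M ++ q ∷ B) → ShortcutAt A p M q B → Shortcut vs
  shortcut-at A p M q B e s = A , p , M ++ q ∷ B , e , M , q , B , refl , s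

  no-repeat : ∀ {vs} → ¬ Shortcut vs → ∀ A p M B → vs ≢ A ++ p ∷ (M ++ p ∷ B)
  no-repeat ns A p M B e = ns (shortcut-at A p M p B e (inj₁ refl))

  no-chord : ∀ {vs} → ¬ Shortcut vs → ∀ A p M q B → vs ≡ A ++ p ∷ (M ++ q ∷ B) →
             Adj G p q → NonEmpty M → NonEmpty (A ++ B) → ⊥
  no-chord ns A p M q B e pq m ab = ns (shortcut-at A p M q B e (inj₂ (pq , m , ab)))

  split-at-index : ∀ (vs : List V) (j : Fin (length vs)) → Σ (List V) λ M → Σ (List V) λ B →
                   (vs ≡ M ++ lookup vs j ∷ B) × (length M ≡ toℕ j)
  split-at-index (a ∷ r) zero    = [] , r , refl , refl
  split-at-index (a ∷ r) (suc j) =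
    let (M , B , e , l) = split-at-index r j in a ∷ M , B , cong (a ∷_) e , cong suc l

  split-at-indices : ∀ (vs : List V) (i j : Fin (length vs)) → toℕ i < toℕ j →
    Σ (List V) λ A → Σ (List V) λ M → Σ (List V) λ B →
    (vs ≡ A ++ lookup vs i ∷ (M ++ lookup vs j ∷ B)) × (length A ≡ toℕ i) × (toℕ j ≡ suc (length A + length M))
  split-at-indices (a ∷ r) zero (suc j) _ =
    let (M , B , e , l) = split-at-index r j in [] , M , B , cong (a ∷_) e , refl , cong suc (sym l)
  split-at-indices (a ∷ r) (suc i) (suc j) (s≤s i<j) =
    let (A , M , B , e , lA , lj) = split-at-indices r i j i<j
    in a ∷ A , M , B , cong (a ∷_) e , cong suc lA , cong suc lj

  length-split : ∀ (A : List V) p M q B → length (A ++ p ∷ (M ++ q ∷ B)) ≡ length A + suc (length M + suc (length B))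
  length-split A p M q B = trans (length-++ A) (cong (λ k → length A + suc k) (length-++ M))

  consecutive-adjacent : ∀ A p q B → IsClosedWalk (A ++ p ∷ q ∷ B) → Adj G p q
  consecutive-adjacent A p q B w = proj₁ (isClosedWalk-rotate A (p ∷ q ∷ B) w)

  closing-adjacent : ∀ p M q → IsClosedWalk (p ∷ (M ++ q ∷ [])) → Adj G q p
  closing-adjacent p M q w = proj₁ (proj₂ (isClosedWalk-split⁻ p M q [] w))

  open import Data.List.Membership.DecPropositional (_≟_ {n}) using (_∈?_)

  parity-avoiding : ∀ x y (P : List V) → (x ∉ P ⊎ y ∉ P) → parity x y P ≡ false
  parity-avoiding x y []          _ = refl
  parity-avoiding x y (a ∷ [])    _ = refl
  parity-avoiding x y (a ∷ b ∷ r) (inj₁ x∉) =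
    cong₂ _xor_ (crosses-false λ { (inj₁ (e , _)) → x∉ (here (sym e)) ; (inj₂ (_ , e)) → x∉ (there (here (sym e))) })
                (parity-avoiding x y (b ∷ r) (inj₁ (x∉ ∘ there)))
  parity-avoiding x y (a ∷ b ∷ r) (inj₂ y∉) =
    cong₂ _xor_ (crosses-false λ { (inj₁ (_ , e)) → y∉ (there (here (sym e))) ; (inj₂ (e , _)) → y∉ (here (sym e)) })
                (parity-avoiding x y (b ∷ r) (inj₂ (y∉ ∘ there)))

  ∈-snoc⁻ : ∀ {z} (r : List V) w → z ∈ (r ∷ʳ w) → z ∈ r ⊎ z ≡ w
  ∈-snoc⁻ r w m with ∈-++⁻ r m
  ... | inj₁ m′       = inj₁ m′
  ... | inj₂ (here e) = inj₂ e

  ∈-closed⁻ : ∀ {z} a (r : List V) → z ∈ (a ∷ (r ∷ʳ a)) → z ∈ (a ∷ r)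
  ∈-closed⁻ a r (here e) = here e
  ∈-closed⁻ a r (there m) with ∈-snoc⁻ r a m
  ... | inj₁ m′ = there m′
  ... | inj₂ e  = here e

  cycParity-visits : ∀ x y (P : List V) → cycParity x y P ≡ true → x ∈ P × y ∈ P
  cycParity-visits x y (a ∷ r) c with x ∈? (a ∷ r) | y ∈? (a ∷ r)
  ... | yes x∈ | yes y∈ = x∈ , y∈
  ... | no x∉  | _      = contradiction (trans (sym c) (parity-avoiding x y _ (inj₁ (x∉ ∘ ∈-closed⁻ a r)))) λ ()
  ... | yes _  | no y∉  = contradiction (trans (sym c) (parity-avoiding x y _ (inj₂ (y∉ ∘ ∈-closed⁻ a r)))) λ ()

  occ : V → List V → ℕ
  occ z [] = 0
  occ z (a ∷ r) with z ≟ a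
  ... | yes _ = suc (occ z r)
  ... | no  _ = occ z r

  occ-++ : ∀ z (xs ys : List V) → occ z (xs ++ ys) ≡ occ z xs + occ z ys
  occ-++ z []       ys = refl
  occ-++ z (a ∷ xs) ys with z ≟ a
  ... | yes _ = cong suc (occ-++ z xs ys)
  ... | no  _ = occ-++ z xs ys

  occ-∈ : ∀ {z} (xs : List V) → z ∈ xs → 1 ≤ occ z xs
  occ-∈ {z} (a ∷ r) m with z ≟ a | m
  ... | yes _  | _        = s≤s z≤n
  ... | no z≢a | here e   = contradiction e z≢a
  ... | no _   | there m′ = occ-∈ r m′

  occ-self : ∀ z → occ z (z ∷ []) ≡ 1
  occ-self z with z ≟ z
  ... | yes _  = refl
  ... | no z≢z = contradiction refl z≢z

  occ-0 : ∀ {z} (xs : List V) → occ z xs ≤ 0 → z ∉ xs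
  occ-0 xs occ≤0 m with ≤-trans (occ-∈ xs m) occ≤0
  ... | ()

  occ-1 : ∀ z (xs : List V) → 1 ≤ occ z xs → Σ (List V) λ M → Σ (List V) λ B → xs ≡ M ++ z ∷ B
  occ-1 z (a ∷ r) le with z ≟ a
  ... | yes refl = [] , r , refl
  ... | no _     = let (M , B , e) = occ-1 z r le in a ∷ M , B , cong (a ∷_) e

  occ-2 : ∀ z (xs : List V) → 2 ≤ occ z xs →
          Σ (List V) λ A → Σ (List V) λ M → Σ (List V) λ B → xs ≡ A ++ z ∷ (M ++ z ∷ B)
  occ-2 z (a ∷ r) le with z ≟ a
  ... | yes refl = let (M , B , e) = occ-1 z r (≤-pred le) in [] , M , B , cong (z ∷_) e
  ... | no _     = let (A , M , B , e) = occ-2 z r le in a ∷ A , M , B , cong (a ∷_) e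

  occ-twice : ∀ y (P Q : List V) → y ∈ P ⊎ y ∈ Q → 2 ≤ occ y (P ++ y ∷ Q)
  occ-twice y P Q h rewrite occ-++ y P (y ∷ Q) | occ-++ y (y ∷ []) Q | occ-self y with h
  ... | inj₁ y∈P = +-mono-≤ (occ-∈ P y∈P) (s≤s z≤n)
  ... | inj₂ y∈Q = ≤-trans (s≤s (occ-∈ Q y∈Q)) (m≤n+m _ (occ y P))

  cycParity-once : ∀ x y → x ≢ y → ∀ (S : List V) → x ∉ S → occ y S ≤ 1 → 3 ≤ length S →
    (Σ (List V) λ M → Σ (List V) λ N → (S ≡ M ++ y ∷ N) × ((M ≡ []) ⊎ (N ≡ []))) →
    cycParity x y (x ∷ S) ≡ true
  cycParity-once x y x≢y .(y ∷ [])      _ _ (s≤s ()) ([] , [] , refl , _)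
  cycParity-once x y x≢y .(y ∷ n ∷ N)   x∉ occ≤1 _ ([] , n ∷ N , refl , inj₁ refl) =
    cong₂ _xor_ (crosses-true {x} {y} {x} {y} (inj₁ (refl , refl)))
                (cong₂ _xor_ (crosses-false {y} {n} {x} {y} λ { (inj₁ (e , _)) → x≢y (sym e) ; (inj₂ (_ , e)) → x∉ (there (here (sym e))) })
                             (parity-avoiding x y (n ∷ (N ∷ʳ x)) (inj₂ y∉)))
    where
    y∉ : y ∉ (n ∷ (N ∷ʳ x))
    y∉ m with ∈-snoc⁻ (n ∷ N) x m
    ... | inj₂ e  = x≢y (sym e)
    ... | inj₁ m′ with ≤-trans (occ-twice y [] (n ∷ N) (inj₂ m′)) occ≤1
    ...   | s≤s ()
  cycParity-once x y x≢y .(m ∷ (M ++ y ∷ [])) x∉ occ≤1 _ (m ∷ M , [] , refl , inj₂ refl) =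
    trans (cycParity-split x y x (m ∷ M) y [])
          (cong₂ _xor_ (cong₂ _xor_ (crosses-false {x} {m} {x} {y} λ { (inj₁ (_ , e)) → y∉ (here (sym e)) ; (inj₂ (e , _)) → x≢y e })
                                    (parity-avoiding x y (m ∷ (M ∷ʳ y)) (inj₁ x∉′)))
                       (cong (_xor false) (crosses-true {y} {x} {x} {y} (inj₂ (refl , refl)))))
    where
    y∉ : y ∉ (m ∷ M)
    y∉ m′ with ≤-trans (occ-twice y (m ∷ M) [] (inj₁ m′)) occ≤1
    ... | s≤s ()
    x∉′ : x ∉ (m ∷ (M ∷ʳ y))
    x∉′ h with ∈-snoc⁻ (m ∷ M) y h
    ... | inj₂ e          = x≢y e
    ... | inj₁ (here e)   = x∉ (here e)
    ... | inj₁ (there h′) = x∉ (there (∈-++⁺ˡ h′))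

  -- A closed walk with at least four vertices and no shortcut is a hole,
  -- and its indicator χ agrees with its edge parity on every edge.
  module Chordless (vs : List V) (4≤len : 4 ≤ length vs) (closed : IsClosedWalk vs) (ns : ¬ Shortcut vs) where

    L : ℕ
    L = length vs

    vert′ : Fin L → V
    vert′ = lookup vs

    vert′-injective : ∀ i j → vert′ i ≡ vert′ j → i ≡ j
    vert′-injective i j e with <-cmp (toℕ i) (toℕ j)
    ... | tri≈ _ i≡j _ = toℕ-injective i≡j
    ... | tri< i<j _ _ =
      let (A , M , B , ev , _) = split-at-indices vs i j i<j
      in ⊥-elim (no-repeat ns A (vert′ i) M B (trans ev (cong (λ z → A ++ vert′ i ∷ (M ++ z ∷ B)) (sym e))))
    ... | tri> _ _ j<i =
      let (A , M , B , ev , _) = split-at-indices vs j i j<i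
      in ⊥-elim (no-repeat ns A (vert′ j) M B (trans ev (cong (λ z → A ++ vert′ j ∷ (M ++ z ∷ B)) e)))

    adjacent-positions : ∀ i j → toℕ i < toℕ j → Adj G (vert′ i) (vert′ j) →
                         (suc (toℕ i) ≡ toℕ j) ⊎ (toℕ i ≡ 0 × suc (toℕ j) ≡ L)
    adjacent-positions i j i<j e with split-at-indices vs i j i<j
    ... | A , [] , B , ev , lA , lj =
      inj₁ (trans (cong suc (trans (sym lA) (sym (+-identityʳ (length A))))) (sym lj))
    ... | [] , m ∷ M , [] , ev , lA , lj =
      inj₂ (sym lA , trans (cong suc lj) (sym (trans (cong length ev) length≡)))
      where
      length≡ : length ([] ++ vert′ i ∷ ((m ∷ M) ++ vert′ j ∷ [])) ≡ suc (suc (suc (length M)))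
      length≡ = trans (length-split [] (vert′ i) (m ∷ M) (vert′ j) []) (cong (λ k → suc (suc k)) (+-comm (length M) 1))
    ... | a ∷ A , m ∷ M , B , ev , _ , _ = ⊥-elim (no-chord ns (a ∷ A) _ (m ∷ M) _ B ev e tt tt)
    ... | [] , m ∷ M , b ∷ B , ev , _ , _ = ⊥-elim (no-chord ns [] _ (m ∷ M) _ (b ∷ B) ev e tt tt)

    next-adjacent : ∀ i j → suc (toℕ i) ≡ toℕ j → Adj G (vert′ i) (vert′ j)
    next-adjacent i j e with split-at-indices vs i j (≤-reflexive e)
    ... | A , [] , B , ev , _ , _ = consecutive-adjacent A (vert′ i) (vert′ j) B (subst IsClosedWalk ev closed)
    ... | A , m ∷ M , B , ev , lA , lj =
      ⊥-elim (m+1+n≢m (length A) (suc-injective (trans (sym lj) (trans (sym e) (cong suc (sym lA))))))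

    last-adjacent : ∀ i j → toℕ i ≡ 0 → suc (toℕ j) ≡ L → Adj G (vert′ j) (vert′ i)
    last-adjacent i j i≡0 sj≡L with split-at-indices vs i j i<j
      where
      i<j : toℕ i < toℕ j
      i<j rewrite i≡0 = ≤-pred (≤-trans (s≤s (s≤s z≤n)) (≤-trans 4≤len (≤-reflexive (sym sj≡L))))
    ... | _ ∷ _ , M , B , ev , lA , lj with trans lA i≡0
    ...   | ()
    last-adjacent i j i≡0 sj≡L | [] , M , [] , ev , lA , lj =
      closing-adjacent (vert′ i) M (vert′ j) (subst IsClosedWalk ev closed)
    last-adjacent i j i≡0 sj≡L | [] , M , b ∷ B , ev , lA , lj =
      ⊥-elim (m+1+n≢m (length M) (sym (suc-injective (trans (suc-injective length≡) (+-suc (length M) (suc (length B)))))))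
      where
      length≡ : suc (suc (length M)) ≡ suc (length M + suc (suc (length B)))
      length≡ = trans (cong suc (sym lj))
                  (trans sj≡L (trans (cong length ev) (length-split [] (vert′ i) M (vert′ j) (b ∷ B))))

    adjacent⇒consec : ∀ i j → Adj G (vert′ i) (vert′ j) → consec L i j ≡ true
    adjacent⇒consec i j e with <-cmp (toℕ i) (toℕ j)
    ... | tri< i<j _ _ with adjacent-positions i j i<j e
    ...   | inj₁ s            = consec-intro L i j (inj₁ s)
    ...   | inj₂ (i≡0 , sj≡L) = consec-intro L i j (inj₂ (inj₂ (inj₁ (i≡0 , sj≡L))))
    adjacent⇒consec i j e | tri≈ _ i≡j _ with toℕ-injective {i = i} {j = j} i≡j
    ... | refl = contradiction (trans (sym e) (Graph.irrefl G (vert′ i))) λ ()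
    adjacent⇒consec i j e | tri> _ _ j<i with adjacent-positions j i j<i (trans (Graph.sym G (vert′ j) (vert′ i)) e)
    ...   | inj₁ s            = consec-intro L i j (inj₂ (inj₁ s))
    ...   | inj₂ (j≡0 , si≡L) = consec-intro L i j (inj₂ (inj₂ (inj₂ (j≡0 , si≡L))))

    consec⇒adjacent : ∀ i j → consec L i j ≡ true → Adj G (vert′ i) (vert′ j)
    consec⇒adjacent i j c with consec-elim L i j c
    ... | inj₁ s                         = next-adjacent i j s
    ... | inj₂ (inj₁ s)                  = trans (Graph.sym G (vert′ i) (vert′ j)) (next-adjacent j i s)
    ... | inj₂ (inj₂ (inj₁ (i≡0 , sj≡L))) = trans (Graph.sym G (vert′ i) (vert′ j)) (last-adjacent i j i≡0 sj≡L)
    ... | inj₂ (inj₂ (inj₂ (j≡0 , si≡L))) = last-adjacent j i j≡0 si≡L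

    hole : Hole G
    hole = record
      { len     = L
      ; len≥4   = 4≤len
      ; vert    = vert′
      ; inj     = λ {i} {j} → vert′-injective i j
      ; induced = λ i j → ≡-by-truth (adjacent⇒consec i j) (consec⇒adjacent i j)
      }

    χ-visits : ∀ x y → χ hole x y ≡ true → x ∈ vs × y ∈ vs
    χ-visits x y h =
      let (i , h′)  = anyFin-sound L _ h
          (j , h″)  = anyFin-sound L _ h′
          (_ , h‴)  = ∧-out (consec L i j) h″
          (ex , ey) = ∧-out (eqF (vert′ i) x) h‴
      in subst (_∈ vs) (eqF-sound _ _ ex) (∈-lookup i) , subst (_∈ vs) (eqF-sound _ _ ey) (∈-lookup j)

    χ-edge : ∀ x y → Adj G x y → x ∈ vs → y ∈ vs → χ hole x y ≡ true
    χ-edge x y e x∈ y∈ =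
      anyFin-intro L _ i (anyFin-intro L _ j
        (∧-in (adjacent⇒consec i j (subst₂ (Adj G) x≡ y≡ e))
              (∧-in (subst (λ z → eqF (vert′ i) z ≡ true) (sym x≡) (eqF-refl (vert′ i)))
                    (subst (λ z → eqF (vert′ j) z ≡ true) (sym y≡) (eqF-refl (vert′ j))))))
      where
      i j : Fin L
      i = index x∈
      j = index y∈
      x≡ : x ≡ vert′ i
      x≡ = lookup-index x∈
      y≡ : y ≡ vert′ j
      y≡ = lookup-index y∈

    occ≤1 : ∀ z → occ z vs ≤ 1
    occ≤1 z with 2 ≤? occ z vs
    ... | yes 2≤ = let (A , M , B , e) = occ-2 z vs 2≤ in ⊥-elim (no-repeat ns A z M B e)
    ... | no 2≰  = ≤-pred (≰⇒> 2≰)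

    -- Rotating vs = A ++ x ∷ B to x ∷ (B ++ A), a neighbour y of x must be
    -- the first or the last vertex of B ++ A, since xy is not a chord.
    neighbour-at-end : ∀ x y A B → vs ≡ A ++ x ∷ B → x ≢ y → Adj G x y → y ∈ vs →
      Σ (List V) λ M → Σ (List V) λ N → (B ++ A ≡ M ++ y ∷ N) × ((M ≡ []) ⊎ (N ≡ []))
    neighbour-at-end x y A B ev x≢y e y∈ with ∈-++⁻ A (subst (y ∈_) ev y∈)
    ... | inj₂ (here y≡x) = contradiction (sym y≡x) x≢y
    ... | inj₂ (there y∈B) with ∈-∃++ y∈B
    ...   | M , N , eB = M , N ++ A , trans (cong (_++ A) eB) (++-assoc M (y ∷ N) A) ,
                         ends A M N (trans ev (cong (λ t → A ++ x ∷ t) eB))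
      where
      ends : ∀ A′ M′ N′ → vs ≡ A′ ++ x ∷ (M′ ++ y ∷ N′) → (M′ ≡ []) ⊎ (N′ ++ A′ ≡ [])
      ends _        []       _        _ = inj₁ refl
      ends []       (m ∷ M′) []       _ = inj₂ refl
      ends []       (m ∷ M′) (z ∷ N′) q = ⊥-elim (no-chord ns [] x (m ∷ M′) y (z ∷ N′) q e tt tt)
      ends (z ∷ A′) (m ∷ M′) N′       q = ⊥-elim (no-chord ns (z ∷ A′) x (m ∷ M′) y N′ q e tt tt)
    neighbour-at-end x y A B ev x≢y e y∈ | inj₁ y∈A with ∈-∃++ y∈A
    ... | M , N , eA = B ++ M , N , trans (cong (B ++_) eA) (sym (++-assoc B M (y ∷ N))) ,
                       ends M N B (trans ev (trans (cong (_++ x ∷ B) eA) (++-assoc M (y ∷ N) (x ∷ B))))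
      where
      e′ : Adj G y x
      e′ = trans (Graph.sym G y x) e
      ends : ∀ M′ N′ B′ → vs ≡ M′ ++ y ∷ (N′ ++ x ∷ B′) → (B′ ++ M′ ≡ []) ⊎ (N′ ≡ [])
      ends _        []       _        _ = inj₂ refl
      ends []       (m ∷ N′) []       _ = inj₁ refl
      ends []       (m ∷ N′) (z ∷ B′) q = ⊥-elim (no-chord ns [] y (m ∷ N′) x (z ∷ B′) q e′ tt tt)
      ends (z ∷ M′) (m ∷ N′) B′       q = ⊥-elim (no-chord ns (z ∷ M′) y (m ∷ N′) x B′ q e′ tt tt)

    cycParity-edge : ∀ x y → x ≢ y → Adj G x y → x ∈ vs → y ∈ vs → cycParity x y vs ≡ true
    cycParity-edge x y x≢y e x∈ y∈ with ∈-∃++ x∈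
    ... | A , B , ev =
      trans (cong (cycParity x y) ev)
        (trans (cycParity-rotate x y A (x ∷ B))
               (cycParity-once x y x≢y (B ++ A) x∉ y-once 3≤ (neighbour-at-end x y A B ev x≢y e y∈)))
      where
      occ-rotated : ∀ z → occ z (B ++ A) + occ z (x ∷ []) ≤ 1
      occ-rotated z = subst (_≤ 1) (trans (cong (occ z) ev) eq) (occ≤1 z)
        where
        regroup : ∀ p w q → p + (w + q) ≡ (q + p) + w
        regroup = solve-∀
        eq : occ z (A ++ x ∷ B) ≡ occ z (B ++ A) + occ z (x ∷ [])
        eq rewrite occ-++ z A (x ∷ B) | occ-++ z (x ∷ []) B | occ-++ z B A = regroup (occ z A) (occ z (x ∷ [])) (occ z B)
      x∉ : x ∉ (B ++ A)
      x∉ = occ-0 (B ++ A) (≤-pred (subst (_≤ 1) (trans (cong (occ x (B ++ A) +_) (occ-self x)) (+-comm (occ x (B ++ A)) 1))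
                                             (occ-rotated x)))
      y-once : occ y (B ++ A) ≤ 1
      y-once = ≤-trans (m≤m+n _ _) (occ-rotated y)
      3≤ : 3 ≤ length (B ++ A)
      3≤ = ≤-pred (subst (4 ≤_) (trans (cong length ev)
             (trans (length-++ A) (trans (+-suc (length A) (length B))
               (cong suc (trans (+-comm (length A) (length B)) (sym (length-++ B))))))) 4≤len)

    cycParity≡χ : ∀ x y → x ≢ y → Adj G x y → cycParity x y vs ≡ χ hole x y
    cycParity≡χ x y x≢y e =
      ≡-by-truth (λ c → let (x∈ , y∈) = cycParity-visits x y vs c in χ-edge x y e x∈ y∈)
                 (λ h → let (x∈ , y∈) = χ-visits x y h in cycParity-edge x y x≢y e x∈ y∈)

  holeSum : List (Hole G) → EdgeVec n
  holeSum = foldr (λ C w → χ C ⊕ w) zeroV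

  holeSum-++ : ∀ Cs Ds x y → holeSum (Cs ++ Ds) x y ≡ holeSum Cs x y xor holeSum Ds x y
  holeSum-++ []       Ds x y = refl
  holeSum-++ (C ∷ Cs) Ds x y =
    trans (cong (χ C x y xor_) (holeSum-++ Cs Ds x y)) (sym (xor-assoc (χ C x y) _ _))

  InNoTriangle : V → V → Set
  InNoTriangle x y = ∀ z → Adj G x z → Adj G y z → ⊥

  HoleSum : List V → Set
  HoleSum vs = Σ (List (Hole G)) λ Cs →
    ∀ x y → x ≢ y → Adj G x y → InNoTriangle x y → cycParity x y vs ≡ holeSum Cs x y

  holeSum-combine : ∀ vs P Q → (∀ x y → cycParity x y vs ≡ cycParity x y P xor cycParity x y Q) →
                    HoleSum P → HoleSum Q → HoleSum vs
  holeSum-combine vs P Q split (Cs , hP) (Ds , hQ) = Cs ++ Ds , λ x y x≢y e nt →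
    trans (split x y) (trans (cong₂ _xor_ (hP x y x≢y e nt) (hQ x y x≢y e nt)) (sym (holeSum-++ Cs Ds x y)))

  triangle-avoids : ∀ x y p q r → Adj G p q → Adj G q r → Adj G r p → InNoTriangle x y → crosses p q x y ≡ false
  triangle-avoids x y p q r pq qr rp nt = crosses-false {p} {q} {x} {y} λ
    { (inj₁ (refl , refl)) → nt r (trans (Graph.sym G x r) rp) qr
    ; (inj₂ (refl , refl)) → nt r qr (trans (Graph.sym G y r) rp) }

  nonEmpty⇒1≤length : ∀ (X : List V) → NonEmpty X → 1 ≤ length X
  nonEmpty⇒1≤length (_ ∷ _) _ = s≤s z≤n

  -- Recursion on a bound f for the length: walks with at
  -- most three vertices are degenerate or triangles and traverse no such
  -- edge an odd number of times; a longer walk without a shortcut is a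
  -- hole; otherwise it is the sum of the two shorter walks at a shortcut.
  decompose : ∀ f (vs : List V) → length vs ≤ f → IsClosedWalk vs → HoleSum vs
  decompose f [] _ _ = [] , λ _ _ _ _ _ → refl
  decompose f (a ∷ []) _ _ = [] , λ x y x≢y _ _ →
    cong (_xor false) (crosses-false {a} {a} {x} {y}
      λ { (inj₁ (e₁ , e₂)) → x≢y (trans (sym e₁) e₂) ; (inj₂ (e₁ , e₂)) → x≢y (trans (sym e₂) e₁) })
  decompose f (a ∷ b ∷ []) _ _ = [] , λ x y _ _ _ →
    trans (cong (λ s → crosses a b x y xor (s xor false)) (crosses-sym b a x y))
          (xor-cancel (crosses a b x y))
    where
    xor-cancel : ∀ s → s xor (s xor false) ≡ false
    xor-cancel false = refl
    xor-cancel true  = refl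
  decompose f (a ∷ b ∷ c ∷ []) _ (ab , bc , ca , _) = [] , λ x y _ _ nt →
    cong₂ _xor_ (triangle-avoids x y a b c ab bc ca nt)
                (cong₂ _xor_ (triangle-avoids x y b c a bc ca ab nt)
                             (cong (_xor false) (triangle-avoids x y c a b ca ab bc nt)))
  decompose f vs@(a ∷ b ∷ c ∷ d ∷ r) _ w with shortcut? vs
  ... | no ns = hole ∷ [] , λ x y x≢y e _ → trans (cycParity≡χ x y x≢y e) (sym (xor-identityʳ (χ hole x y)))
    where open Chordless vs (s≤s (s≤s (s≤s (s≤s z≤n)))) w ns
  decompose zero    (a ∷ b ∷ c ∷ d ∷ r) () w | yes _
  decompose (suc f) vs@(a ∷ b ∷ c ∷ d ∷ r) len≤ w | yes (A , p , R , e₁ , M , q , B , e₂ , s) = at-shortcut s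
    where
    vs≡ : vs ≡ A ++ p ∷ (M ++ q ∷ B)
    vs≡ = trans e₁ (cong (λ t → A ++ p ∷ t) e₂)
    length≡ : length vs ≡ length A + suc (length M + suc (length B))
    length≡ = trans (cong length vs≡) (length-split A p M q B)
    w′ : IsClosedWalk (A ++ p ∷ (M ++ q ∷ B))
    w′ = subst IsClosedWalk vs≡ w
    recurse : ∀ P → suc (length P) ≤ length vs → IsClosedWalk P → HoleSum P
    recurse P shorter = decompose f P (≤-pred (≤-trans shorter len≤))
    at-shortcut : ShortcutAt A p M q B → HoleSum vs
    at-shortcut (inj₁ refl) =
      holeSum-combine vs (p ∷ M) (A ++ p ∷ B)
        (λ x y → trans (cong (cycParity x y) vs≡) (cycParity-repeat x y A p M B))
        (recurse (p ∷ M) (subst (suc (length (p ∷ M)) ≤_) (sym length≡) (repeat-shorter-loop (length A) (length M) (length B)))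
                 (proj₁ (isClosedWalk-repeat A p M B w′)))
        (recurse (A ++ p ∷ B) (subst₂ _≤_ (cong suc (sym (length-++ A))) (sym length≡)
                                      (repeat-shorter-rest (length A) (length M) (length B)))
                 (proj₂ (isClosedWalk-repeat A p M B w′)))
    at-shortcut (inj₂ (pq , M≢[] , AB≢[])) =
      holeSum-combine vs (p ∷ (M ++ q ∷ [])) (A ++ p ∷ q ∷ B)
        (λ x y → trans (cong (cycParity x y) vs≡) (cycParity-chord x y A p M q B))
        (recurse (p ∷ (M ++ q ∷ [])) (subst₂ _≤_ (cong (λ k → suc (suc k)) (sym (length-++ M))) (sym length≡)
                   (chord-shorter-loop (length A) (length M) (length B)
                     (subst (1 ≤_) (length-++ A) (nonEmpty⇒1≤length (A ++ B) AB≢[]))))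
                 (proj₁ (isClosedWalk-chord A p M q B pq w′)))
        (recurse (A ++ p ∷ q ∷ B) (subst₂ _≤_ (cong suc (sym (length-++ A))) (sym length≡)
                   (chord-shorter-rest (length A) (length M) (length B) (nonEmpty⇒1≤length M M≢[])))
                 (proj₂ (isClosedWalk-chord A p M q B pq w′)))

adjSum : ∀ {n k} → Graph n → Fin n ⊎ Fin k → Fin n ⊎ Fin k → Bool
adjSum H (inj₁ a) (inj₁ b) = adj H a b
adjSum H _        _        = false

adjIso-splitAt : ∀ {n} k (H : Graph n) x y → adjIso k H x y ≡ adjSum H (splitAt n x) (splitAt n y)
adjIso-splitAt {n} k H x y with splitAt n x | splitAt n y
... | inj₁ a | inj₁ b = refl
... | inj₁ a | inj₂ b = refl
... | inj₂ a | inj₁ b = refl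
... | inj₂ a | inj₂ b = refl

-- Let D′ be acyclic with C(D′) = G′ ∪ I₁,
-- G′ ⊆ G, and let edge₁, …, edgeₘ (m ≤ d) be edges of G listing every edge
-- of G outside G′.  Give each edgeₛ a fresh sink with arcs from both of its
-- ends; the result is acyclic (sinks have no out-arcs) and its competition
-- graph is G ∪ I_{1+d} (unused sinks stay isolated).
module Extension {n d : ℕ} (G G′ : Graph n) (G′⊆G : SpanningSubgraph G′ G)
    (D′ : Digraph (n + 1)) (D′-acyclic : Acyclic D′) (D′-competition : IsCompetitionGraphOf 1 G′ D′)
    (m : ℕ) (edge : Fin m → Fin n × Fin n) (m≤d : m ≤ d)
    (edge-in-G : ∀ s → Adj G (proj₁ (edge s)) (proj₂ (edge s)))
    (edge-complete : ∀ a b → toℕ a < toℕ b → Adj G a b → ¬ Adj G′ a b → Σ (Fin m) λ s → edge s ≡ (a , b)) where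

  -- The vertices of the new digraph: those of G, the isolated vertex of
  -- the realisation of G′, and d sinks.
  data Node : Set where
    old  : Fin n → Node
    iso  : Node
    sink : Fin d → Node

  fromSum : Fin n ⊎ Fin (suc d) → Node
  fromSum (inj₁ a)       = old a
  fromSum (inj₂ zero)    = iso
  fromSum (inj₂ (suc t)) = sink t

  toSum : Node → Fin n ⊎ Fin (suc d)
  toSum (old a)  = inj₁ a
  toSum iso      = inj₂ zero
  toSum (sink t) = inj₂ (suc t)

  decode : Fin (n + suc d) → Node
  decode x = fromSum (splitAt n x)

  encode : Node → Fin (n + suc d)
  encode c = join n (suc d) (toSum c)

  decode-encode : ∀ c → decode (encode c) ≡ c
  decode-encode c = trans (cong fromSum (splitAt-join n (suc d) (toSum c))) (lemma c)
    where
    lemma : ∀ c → fromSum (toSum c) ≡ c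
    lemma (old a)  = refl
    lemma iso      = refl
    lemma (sink t) = refl

  decode-injective : ∀ x y → decode x ≡ decode y → x ≡ y
  decode-injective x y e =
    trans (sym (join-splitAt n (suc d) x))
          (trans (cong (join n (suc d)) (fromSum-injective _ _ e)) (join-splitAt n (suc d) y))
    where
    fromSum-injective : ∀ s s′ → fromSum s ≡ fromSum s′ → s ≡ s′
    fromSum-injective (inj₁ a)       (inj₁ .a)       refl = refl
    fromSum-injective (inj₂ zero)    (inj₂ zero)     refl = refl
    fromSum-injective (inj₂ (suc t)) (inj₂ (suc .t)) refl = refl
    fromSum-injective (inj₁ _)       (inj₂ zero)     ()
    fromSum-injective (inj₁ _)       (inj₂ (suc _))  ()
    fromSum-injective (inj₂ zero)    (inj₁ _)        ()
    fromSum-injective (inj₂ zero)    (inj₂ (suc _))  ()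
    fromSum-injective (inj₂ (suc _)) (inj₁ _)        ()
    fromSum-injective (inj₂ (suc _)) (inj₂ zero)     ()

  data Inherited : Node → Set where
    old : ∀ a → Inherited (old a)
    iso : Inherited iso

  inherited-or-sink : ∀ c → Inherited c ⊎ (Σ (Fin d) λ t → c ≡ sink t)
  inherited-or-sink (old a)  = inj₁ (old a)
  inherited-or-sink iso      = inj₁ iso
  inherited-or-sink (sink t) = inj₂ (t , refl)

  base : ∀ {c} → Inherited c → Fin (n + 1)
  base (old a) = a ↑ˡ 1
  base iso     = n ↑ʳ zero

  -- a is an end of the edge whose sink is t.
  feeds : Fin n → Fin d → Bool
  feeds a t = anyFin m (λ s → (toℕ s ≡ᵇ toℕ t) ∧ (eqF a (proj₁ (edge s)) ∨ eqF a (proj₂ (edge s))))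

  arc : Node → Node → Bool
  arc (sink _) _        = false
  arc (old a)  (sink t) = feeds a t
  arc iso      (sink t) = false
  arc (old a)  (old b)  = D′ (base (old a)) (base (old b))
  arc (old a)  iso      = D′ (base (old a)) (base iso)
  arc iso      (old b)  = D′ (base iso) (base (old b))
  arc iso      iso      = D′ (base iso) (base iso)

  arc-inherited : ∀ {c c′} (i : Inherited c) (i′ : Inherited c′) → arc c c′ ≡ D′ (base i) (base i′)
  arc-inherited (old a) (old b) = refl
  arc-inherited (old a) iso     = refl
  arc-inherited iso     (old b) = refl
  arc-inherited iso     iso     = refl

  D : Digraph (n + suc d)
  D x y = arc (decode x) (decode y)

  sink-no-arc : ∀ {x} t → decode x ≡ sink t → ∀ y → ¬ Arc D x y
  sink-no-arc {x} t e y a with decode x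
  sink-no-arc t refl y () | .(sink t)

  first-arc : ∀ {A : Set} {R : A → A → Set} {x y} → TransClosure R x y → Σ A λ w → R x w
  first-arc [ r ]   = _ , r
  first-arc (r ∷ _) = _ , r

  -- A directed walk of D between inherited nodes avoids the sinks, so it
  -- is a walk of D′.
  to-D′ : ∀ {x y} → TransClosure (Arc D) x y → (i : Inherited (decode x)) (j : Inherited (decode y)) →
          TransClosure (Arc D′) (base i) (base j)
  to-D′ [ r ] i j = [ trans (sym (arc-inherited i j)) r ]
  to-D′ (_∷_ {y = z} r rest) i j with inherited-or-sink (decode z)
  ... | inj₁ k       = trans (sym (arc-inherited i k)) r ∷ to-D′ rest k j
  ... | inj₂ (t , e) = ⊥-elim (sink-no-arc t e _ (proj₂ (first-arc rest)))

  D-acyclic : Acyclic D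
  D-acyclic v cycle with inherited-or-sink (decode v)
  ... | inj₁ i       = D′-acyclic _ (to-D′ cycle i i)
  ... | inj₂ (t , e) = sink-no-arc t e _ (proj₂ (first-arc cycle))

  adjNode : Graph n → Node → Node → Bool
  adjNode H (old a) (old b) = adj H a b
  adjNode H _       _       = false

  adjNode-mono : ∀ c c′ → adjNode G′ c c′ ≡ true → adjNode G c c′ ≡ true
  adjNode-mono (old a) (old b) e = G′⊆G a b e

  adjIso-decode : ∀ x y → adjIso (suc d) G x y ≡ adjNode G (decode x) (decode y)
  adjIso-decode x y = trans (adjIso-splitAt (suc d) G x y) (lemma (splitAt n x) (splitAt n y))
    where
    lemma : ∀ s s′ → adjSum G s s′ ≡ adjNode G (fromSum s) (fromSum s′)
    lemma (inj₁ a)       (inj₁ b)       = refl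
    lemma (inj₁ a)       (inj₂ zero)    = refl
    lemma (inj₁ a)       (inj₂ (suc _)) = refl
    lemma (inj₂ zero)    _              = refl
    lemma (inj₂ (suc _)) _              = refl

  baseSum : ∀ {c} → Inherited c → Fin n ⊎ Fin 1
  baseSum (old a) = inj₁ a
  baseSum iso     = inj₂ zero

  splitAt-base : ∀ {c} (i : Inherited c) → splitAt n (base i) ≡ baseSum i
  splitAt-base (old a) = splitAt-↑ˡ n a 1
  splitAt-base iso     = splitAt-↑ʳ n 1 zero

  adjIso-base : ∀ {c c′} (i : Inherited c) (i′ : Inherited c′) → adjIso 1 G′ (base i) (base i′) ≡ adjNode G′ c c′
  adjIso-base i i′ =
    trans (adjIso-splitAt 1 G′ (base i) (base i′)) (trans (cong₂ (adjSum G′) (splitAt-base i) (splitAt-base i′)) (lemma i i′))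
    where
    lemma : ∀ {c c′} (i : Inherited c) (i′ : Inherited c′) → adjSum G′ (baseSum i) (baseSum i′) ≡ adjNode G′ c c′
    lemma (old a) (old b) = refl
    lemma (old a) iso     = refl
    lemma iso     (old b) = refl
    lemma iso     iso     = refl

  base-injective : ∀ {c c′} (i : Inherited c) (i′ : Inherited c′) → base i ≡ base i′ → c ≡ c′
  base-injective i i′ e = lemma i i′ (trans (sym (splitAt-base i)) (trans (cong (splitAt n) e) (splitAt-base i′)))
    where
    lemma : ∀ {c c′} (i : Inherited c) (i′ : Inherited c′) → baseSum i ≡ baseSum i′ → c ≡ c′
    lemma (old a) (old .a) refl = refl
    lemma iso     iso      _    = refl

  lift : (w : Fin (n + 1)) → Σ Node λ c → Σ (Inherited c) λ i → base i ≡ w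
  lift w = let (c , i , e) = liftSum (splitAt n w) in c , i , trans e (join-splitAt n 1 w)
    where
    liftSum : ∀ s → Σ Node λ c → Σ (Inherited c) λ i → base i ≡ join n 1 s
    liftSum (inj₁ a)    = old a , old a , refl
    liftSum (inj₂ zero) = iso , iso , refl

  feeds-end : ∀ a s → (proj₁ (edge s) ≡ a) ⊎ (proj₂ (edge s) ≡ a) → feeds a (inject≤ s m≤d) ≡ true
  feeds-end a s end = anyFin-intro m _ s (∧-in (≡ᵇ-complete (sym (toℕ-inject≤ s m≤d))) (is-end end))
    where
    is-end : (proj₁ (edge s) ≡ a) ⊎ (proj₂ (edge s) ≡ a) → (eqF a (proj₁ (edge s)) ∨ eqF a (proj₂ (edge s))) ≡ true
    is-end (inj₁ refl) = ∨-inˡ _ (eqF-refl a)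
    is-end (inj₂ refl) = ∨-inʳ (eqF a (proj₁ (edge s))) (eqF-refl a)

  feeds-sound : ∀ a t → feeds a t ≡ true →
                Σ (Fin m) λ s → (toℕ s ≡ toℕ t) × ((a ≡ proj₁ (edge s)) ⊎ (a ≡ proj₂ (edge s)))
  feeds-sound a t f with anyFin-sound m _ f
  ... | s , h with ∧-out (toℕ s ≡ᵇ toℕ t) h
  ...   | s≡t , end with ∨-out (eqF a (proj₁ (edge s))) end
  ...     | inj₁ e = s , ≡ᵇ-sound _ _ s≡t , inj₁ (eqF-sound _ _ e)
  ...     | inj₂ e = s , ≡ᵇ-sound _ _ s≡t , inj₂ (eqF-sound _ _ e)

  common-sink⇒adjacent : ∀ a b t → a ≢ b → feeds a t ≡ true → feeds b t ≡ true → Adj G a b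
  common-sink⇒adjacent a b t a≢b fa fb with feeds-sound a t fa | feeds-sound b t fb
  ... | s , s≡t , ea | s′ , s′≡t , eb with toℕ-injective {i = s} {j = s′} (trans s≡t (sym s′≡t))
  ...   | refl with ea | eb
  ...     | inj₁ refl | inj₁ refl = contradiction refl a≢b
  ...     | inj₁ refl | inj₂ refl = edge-in-G s
  ...     | inj₂ refl | inj₁ refl = trans (Graph.sym G _ _) (edge-in-G s)
  ...     | inj₂ refl | inj₂ refl = contradiction refl a≢b

  new-edge-sink : ∀ a b → a ≢ b → Adj G a b → ¬ Adj G′ a b → Σ (Fin d) λ t → (feeds a t ≡ true) × (feeds b t ≡ true)
  new-edge-sink a b a≢b e ¬e′ with <-cmp (toℕ a) (toℕ b)
  ... | tri< a<b _ _ = let (s , es) = edge-complete a b a<b e ¬e′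
                       in inject≤ s m≤d , feeds-end a s (inj₁ (cong proj₁ es)) , feeds-end b s (inj₂ (cong proj₂ es))
  ... | tri≈ _ a≡b _ = contradiction (toℕ-injective a≡b) a≢b
  ... | tri> _ _ b<a = let (s , es) = edge-complete b a b<a (trans (Graph.sym G b a) e) (¬e′ ∘ trans (Graph.sym G′ a b))
                       in inject≤ s m≤d , feeds-end a s (inj₂ (cong proj₂ es)) , feeds-end b s (inj₁ (cong proj₁ es))

  -- Adjacent nodes have a common out-neighbour: in D′ if the edge is in G′,
  -- else the sink of the edge.
  adjacent⇒common : ∀ c c′ → c ≢ c′ → adjNode G c c′ ≡ true → Σ Node λ w → (arc c w ≡ true) × (arc c′ w ≡ true)
  adjacent⇒common (old a) (old b) c≢c′ e with adj G′ a b in e′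
  ... | true =
    let (w , p , q) = Equivalence.to (D′-competition (a ↑ˡ 1) (b ↑ˡ 1) (c≢c′ ∘ cong old ∘ ↑ˡ-injective 1 a b))
                                     (trans (adjIso-base (old a) (old b)) e′)
        (c , k , base≡w) = lift w
    in c , trans (arc-inherited (old a) k) (subst (Arc D′ (a ↑ˡ 1)) (sym base≡w) p)
         , trans (arc-inherited (old b) k) (subst (Arc D′ (b ↑ˡ 1)) (sym base≡w) q)
  ... | false =
    let (t , fa , fb) = new-edge-sink a b (c≢c′ ∘ cong old) e (λ e″ → contradiction (trans (sym e′) e″) λ ())
    in sink t , fa , fb

  -- Nodes with a common out-neighbour are adjacent: via the competition
  -- graph G′ ∪ I₁ of D′, or via a shared sink.
  common⇒adjacent : ∀ c c′ w → c ≢ c′ → arc c w ≡ true → arc c′ w ≡ true → adjNode G c c′ ≡ true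
  common⇒adjacent c c′ w c≢c′ p q with inherited-or-sink c | inherited-or-sink c′ | inherited-or-sink w
  ... | inj₂ (_ , refl) | _               | _ = contradiction p λ ()
  ... | inj₁ _          | inj₂ (_ , refl) | _ = contradiction q λ ()
  ... | inj₁ i | inj₁ i′ | inj₁ k =
    adjNode-mono c c′ (trans (sym (adjIso-base i i′))
      (Equivalence.from (D′-competition (base i) (base i′) (c≢c′ ∘ base-injective i i′))
        (base k , trans (sym (arc-inherited i k)) p , trans (sym (arc-inherited i′ k)) q)))
  ... | inj₁ i | inj₁ i′ | inj₂ (t , refl) = via-sink i i′ c≢c′ p q
    where
    via-sink : ∀ {c c′} → Inherited c → Inherited c′ → c ≢ c′ → arc c (sink t) ≡ true → arc c′ (sink t) ≡ true →
               adjNode G c c′ ≡ true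
    via-sink (old a) (old b) c≢c′ p q = common-sink⇒adjacent a b t (c≢c′ ∘ cong old) p q
    via-sink iso     _       _    () _
    via-sink (old a) iso     _    _  ()

  D-competition : IsCompetitionGraphOf (suc d) G D
  D-competition x y x≢y = mk⇔ to from
    where
    c≢c′ : decode x ≢ decode y
    c≢c′ = x≢y ∘ decode-injective x y
    to : adjIso (suc d) G x y ≡ true → ∃ λ v → Arc D x v × Arc D y v
    to e = let (w , p , q) = adjacent⇒common (decode x) (decode y) c≢c′ (trans (sym (adjIso-decode x y)) e)
           in encode w , subst (λ z → arc (decode x) z ≡ true) (sym (decode-encode w)) p
                       , subst (λ z → arc (decode y) z ≡ true) (sym (decode-encode w)) q
    from : (∃ λ v → Arc D x v × Arc D y v) → adjIso (suc d) G x y ≡ true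
    from (v , p , q) = trans (adjIso-decode x y) (common⇒adjacent (decode x) (decode y) (decode v) c≢c′ p q)

  realizable : Realizable G (suc d)
  realizable = D , D-acyclic , D-competition

module FundamentalCycles {n : ℕ} (G G′ : Graph n) (G′⊆G : SpanningSubgraph G′ G)
                         (triangles : ContainsAllTriangles G′ G) where
  open Walks G

  later : ∀ {a b} → Star (Adj G′) a b → List V
  later ε                  = []
  later (_◅_ {j = c} _ s) = c ∷ later s

  earlier : ∀ {a b} → Star (Adj G′) a b → List V
  earlier ε           = []
  earlier {a} (_ ◅ s) = a ∷ earlier s

  earlier-snoc : ∀ {a b} (s : Star (Adj G′) a b) → earlier s ∷ʳ b ≡ a ∷ later s
  earlier-snoc ε           = refl
  earlier-snoc {a} (_ ◅ s) = cong (a ∷_) (earlier-snoc s)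

  G′-walk : ∀ {a b} (s : Star (Adj G′) a b) → IsWalk (a ∷ later s)
  G′-walk ε       = tt
  G′-walk (e ◅ s) = G′⊆G _ _ e , G′-walk s

  G′-walk-parity : ∀ x y → ¬ Adj G′ x y → ∀ {a b} (s : Star (Adj G′) a b) → parity x y (a ∷ later s) ≡ false
  G′-walk-parity x y ¬xy ε = refl
  G′-walk-parity x y ¬xy {a} (_◅_ {j = c} e s) = cong₂ _xor_ (crosses-false {a} {c} {x} {y} no-cross) (G′-walk-parity x y ¬xy s)
    where
    no-cross : ¬ Crosses a c x y
    no-cross (inj₁ (refl , refl)) = ¬xy e
    no-cross (inj₂ (refl , refl)) = ¬xy (trans (Graph.sym G′ x y) e)

  outside-G′⇒no-triangle : ∀ x y → Adj G x y → ¬ Adj G′ x y → InNoTriangle x y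
  outside-G′⇒no-triangle x y xy ¬xy z xz yz = ¬xy (proj₁ (triangles x y z xy yz xz))

  -- If G′ is connected, every edge uv of G has a sum of holes which, on
  -- the edges outside G′, is the indicator of uv: close a G′-walk from v
  -- to u by uv and decompose the resulting closed walk.
  Fundamental : V → V → Set
  Fundamental u v = Σ (List (Hole G)) λ Cs →
    ∀ x y → x ≢ y → Adj G x y → ¬ Adj G′ x y → holeSum Cs x y ≡ crosses u v x y

  fundamental : Connected G′ → ∀ u v → Adj G u v → Fundamental u v
  fundamental connected u v uv = Cs , λ x y x≢y xy ¬xy → begin
    holeSum Cs x y
      ≡⟨ sym (sums x y x≢y xy (outside-G′⇒no-triangle x y xy ¬xy)) ⟩
    cycParity x y (u ∷ earlier path)
      ≡⟨ cong (λ L → parity x y (u ∷ L)) (earlier-snoc path) ⟩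
    crosses u v x y xor parity x y (v ∷ later path)
      ≡⟨ cong (crosses u v x y xor_) (G′-walk-parity x y ¬xy path) ⟩
    crosses u v x y xor false
      ≡⟨ xor-identityʳ _ ⟩
    crosses u v x y ∎
    where
    open ≡-Reasoning
    path : Star (Adj G′) v u
    path = connected v u
    closed : IsClosedWalk (u ∷ earlier path)
    closed = subst (λ L → IsWalk (u ∷ L)) (sym (earlier-snoc path)) (uv , G′-walk path)
    decomposition : HoleSum (u ∷ earlier path)
    decomposition = decompose _ (u ∷ earlier path) ≤-refl closed
    Cs : List (Hole G)
    Cs = proj₁ decomposition
    sums : ∀ x y → x ≢ y → Adj G x y → InNoTriangle x y → cycParity x y (u ∷ earlier path) ≡ holeSum Cs x y
    sums = proj₂ decomposition

NewEdge : ∀ {n} → Graph n → Graph n → Fin n × Fin n → Set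
NewEdge G G′ (x , y) = (toℕ x < toℕ y) × Adj G x y × ¬ Adj G′ x y

newEdge? : ∀ {n} (G G′ : Graph n) p → Dec (NewEdge G G′ p)
newEdge? G G′ (x , y) = (toℕ x <? toℕ y) ×-dec ((adj G x y ≟𝔹 true) ×-dec ¬? (adj G′ x y ≟𝔹 true))

-- An injective enumeration edge : Fin m → Fin n × Fin n of the new edges,
-- obtained by enumerating Fin (n * n) ≅ Fin n × Fin n.
module NewEdges {n : ℕ} (G G′ : Graph n) where

  private
    enumeration : Enumeration (NewEdge G G′ ∘ remQuot n)
    enumeration = enumerate _ (newEdge? G G′ ∘ remQuot n)
    open Enumeration enumeration

  m : ℕ
  m = size

  edge : Fin m → Fin n × Fin n
  edge = remQuot n ∘ elem

  edge-new : ∀ s → NewEdge G G′ (edge s)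
  edge-new = sound

  edge-injective : ∀ s t → edge s ≡ edge t → s ≡ t
  edge-injective s t e =
    injective s t (trans (sym (combine-remQuot {n} n (elem s))) (trans (cong (uncurry combine) e) (combine-remQuot {n} n (elem t))))

  edge-complete : ∀ a b → toℕ a < toℕ b → Adj G a b → ¬ Adj G′ a b → Σ (Fin m) λ s → edge s ≡ (a , b)
  edge-complete a b a<b ab ¬ab =
    let (s , es) = complete (combine a b) (subst (NewEdge G G′) (sym (remQuot-combine a b)) (a<b , ab , ¬ab))
    in s , trans (cong (remQuot n) es) (remQuot-combine a b)

-- The hole space has dimension at least the number of new edges: the
-- fundamental hole sums h_s of the new edges, written in a basis
-- (coordinates a_s), and the basis evaluated at the new edges (vectors
-- c_t) form a biorthogonal system a_s · c_t = h_s(edge t) = [s = t].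
newEdges≤dim : ∀ {n} (G G′ : Graph n) → Connected G′ → SpanningSubgraph G′ G → ContainsAllTriangles G′ G →
               ∀ d → HoleSpaceDim G d → NewEdges.m G G′ ≤ d
newEdges≤dim {n} G G′ connected G′⊆G triangles d (b , _ , _ , coordinates) =
  biorthogonal⇒≤ d m a c (λ t → trans (a·c t t) (crosses-true {u t} {v t} {u t} {v t} (inj₁ (refl , refl))))
                         (λ t s t≢s → trans (a·c t s) (crosses-false {u t} {v t} {u s} {v s} (distinct t s t≢s)))
  where
  open Walks G
  open NewEdges G G′
  open FundamentalCycles G G′ G′⊆G triangles
  u v : Fin m → Fin n
  u = proj₁ ∘ edge
  v = proj₂ ∘ edge
  u<v : ∀ s → toℕ (u s) < toℕ (v s)
  u<v s = proj₁ (edge-new s)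
  holes : ∀ s → Fundamental (u s) (v s)
  holes s = fundamental connected (u s) (v s) (proj₁ (proj₂ (edge-new s)))
  expansion : ∀ s → Σ (Fin d → Bool) λ a → _≈E_ {G = G} (holeSum (proj₁ (holes s))) (linComb a b)
  expansion s = coordinates (holeSum (proj₁ (holes s))) (proj₁ (holes s) , λ _ _ _ _ → refl)
  a c : Fin m → Fin d → Bool
  a s = proj₁ (expansion s)
  c t i = b i (u t) (v t)
  a·c : ∀ s t → a s · c t ≡ crosses (u s) (v s) (u t) (v t)
  a·c s t = trans (sym (proj₂ (expansion s) (u t) (v t) (u<v t) (proj₁ (proj₂ (edge-new t)))))
                  (proj₂ (holes s) (u t) (v t) (λ e → <-irrefl (cong toℕ e) (u<v t))
                                   (proj₁ (proj₂ (edge-new t))) (proj₂ (proj₂ (edge-new t))))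
  distinct : ∀ s t → s ≢ t → ¬ Crosses (u s) (v s) (u t) (v t)
  distinct s t s≢t (inj₁ (e₁ , e₂)) = s≢t (edge-injective s t (cong₂ _,_ e₁ e₂))
  distinct s t s≢t (inj₂ (e₁ , e₂)) = <-asym (u<v t) (subst₂ (λ p q → toℕ p < toℕ q) e₁ e₂ (u<v s))

-- G ∪ I_{1+d} is realisable because m ≤ d, and k(G) is the least k for
-- which G ∪ I_k is realisable.
mainTheorem6 : ∀ {n} (G G′ : Graph n) → Connected G →
    Connected G′ → SpanningSubgraph G′ G → ContainsAllTriangles G′ G →
    IsCompetitionNumber G′ 1 →
    ∀ d → HoleSpaceDim G d → ∀ k → IsCompetitionNumber G k → k ≤ d + 1
mainTheorem6 G G′ _ connected G′⊆G triangles ((D′ , acyclic , competition) , _) d dim k (_ , minimal) =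
  ≮⇒≥ λ d+1<k → minimal (d + 1) d+1<k (subst (Realizable G) (+-comm 1 d) realizable)
  where
  open NewEdges G G′
  m≤d : m ≤ d
  m≤d = newEdges≤dim G G′ connected G′⊆G triangles d dim
  realizable : Realizable G (suc d)
  realizable = Extension.realizable G G′ G′⊆G D′ acyclic competition m edge m≤d
                 (proj₁ ∘ proj₂ ∘ edge-new) edge-complete
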